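{- Let $G$ be a graph whose node set is finite of cardinality $n$, and let $x,y:\mathsf{N}_G$. Then $$\sum_{w:\mathsf{W}_G(x,y)}\mathsf{isQuasi}(w)\ \simeq\ \sum_{m:⟦n+1⟧}\mathsf{qswalk}(m,x,y),$$ where $m:⟦n+1⟧$ is regarded as a natural number $m\le n$.
   Context: Setting: homotopy type theory. $⟦k⟧$ is the $k$-element type, identified with $\{0,\dots,k-1\}$; a type $X$ is finite of cardinality $n$ if $\|X\simeq⟦n⟧\|$. A graph $G$: a set $\mathsf{N}_G$ of nodes and sets $\mathsf{E}_G(x,y)$ of edges. Walks: inductive family $\mathsf{W}_G(x,y)$ with $\langle x\rangle:\mathsf{W}_G(x,x)$ and $e\odot w:\mathsf{W}_G(x,z)$ for $e:\mathsf{E}_G(x,y)$, $w:\mathsf{W}_G(y,z)$; $\mathsf{length}$ counts edges. For a node $u$: $u\in\langle z\rangle:\equiv\mathbb{0}$, $u\in(e\odot w):\equiv(u=\mathsf{source}(e))+(u\in w)$. $\mathsf{isQuasi}(w):\equiv\prod_u\mathsf{isProp}(u\in w)$. $\mathsf{qswalk}(m,x,y):\equiv\sum_{w:\mathsf{W}_G(x,y)}\mathsf{isQuasi}(w)\times(\mathsf{length}(w)=m)$. -}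

module Defs where

open import Data.Nat using (ℕ; zero; suc)
open import Data.Fin using (Fin)
open import Data.Empty using (⊥)
open import Data.Sum using (_⊎_)
open import Data.Product using (Σ; _×_)
open import Relation.Binary.PropositionalEquality using (_≡_)
open import Function.Properties.Inverse.HalfAdjointEquivalence public using (_≃_)

isProp : Set → Set
isProp A = (a b : A) → a ≡ b

isSet : Set → Set
isSet A = (a b : A) → isProp (a ≡ b)

-- Propositional truncation, impredicative encoding (eliminates into
-- propositions of Set₀, which is all that is needed here).
∥_∥ : Set → Set₁
∥ A ∥ = (P : Set) → isProp P → (A → P) → P

⟦_⟧ : ℕ → Set
⟦ k ⟧ = Fin k

isFinOfCard : ℕ → Set → Set₁
isFinOfCard n X = ∥ X ≃ ⟦ n ⟧ ∥

record Graph : Set₁ where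
  field
    N : Set
    N-isSet : isSet N
    E : N → N → Set
    E-isSet : (x y : N) → isSet (E x y)
open Graph public

module _ (G : Graph) where

  data W : N G → N G → Set where
    ⟨_⟩ : (x : N G) → W x x
    _⊙_ : {x y z : N G} → E G x y → W y z → W x z

  length : {x y : N G} → W x y → ℕ
  length ⟨ _ ⟩ = zero
  length (e ⊙ w) = suc (length w)

  _∈_ : N G → {x y : N G} → W x y → Set
  u ∈ ⟨ _ ⟩ = ⊥
  _∈_ u {x} (e ⊙ w) = (u ≡ x) ⊎ (u ∈ w)

  isQuasi : {x y : N G} → W x y → Set
  isQuasi w = (u : N G) → isProp (u ∈ w)

  qswalk : ℕ → N G → N G → Set
  qswalk m x y = Σ (W x y) (λ w → isQuasi w × (length w ≡ m))

{-# OPTIONS --safe #-}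
module Submission where

open import Defs
open import Data.Nat using (ℕ; suc; _≤_; s≤s)
open import Data.Nat.Properties using (≤-irrelevant; ≡-irrelevant)
open import Data.Fin using (Fin; toℕ; fromℕ<)
open import Data.Fin.Properties using (toℕ-injective; toℕ-fromℕ<; injective⇒≤)
open import Data.Product using (Σ; _,_; _×_)
open import Data.Sum using (inj₁; inj₂)
open import Function using (_∘_)
open import Function.Bundles using (mk↔ₛ′)
open import Function.Definitions using (Injective)
open import Function.Properties.Inverse.HalfAdjointEquivalence using (↔⇒≃)
open import Relation.Binary.PropositionalEquality using (_≡_; refl; sym; trans; cong; subst; module ≡-Reasoning)

-- A quasi-simple walk visits at most n distinct sources, one per edge, so its length is at most n;
-- hence grading quasi-simple walks by length only needs the lengths 0, …, n.

Σ≃Σ-graded : {A : Set} (P : A → Set) (f : A → ℕ) (n : ℕ) → (∀ a → P a → f a ≤ n) →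
  Σ A P ≃ Σ (Fin (suc n)) (λ m → Σ A (λ a → P a × f a ≡ toℕ m))
Σ≃Σ-graded {A} P f n bound = ↔⇒≃ (mk↔ₛ′ grade forget grade∘forget (λ _ → refl))
  where
  grade : Σ A P → Σ (Fin (suc n)) (λ m → Σ A (λ a → P a × f a ≡ toℕ m))
  grade (a , p) = fromℕ< (s≤s (bound a p)) , a , p , sym (toℕ-fromℕ< (s≤s (bound a p)))

  forget : Σ (Fin (suc n)) (λ m → Σ A (λ a → P a × f a ≡ toℕ m)) → Σ A P
  forget (_ , a , p , _) = a , p

  grade-unique : (a : A) (p : P a) (m m′ : Fin (suc n)) (e : f a ≡ toℕ m) (e′ : f a ≡ toℕ m′) →
    _≡_ {A = Σ (Fin (suc n)) (λ m → Σ A (λ a → P a × f a ≡ toℕ m))} (m , a , p , e) (m′ , a , p , e′)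
  grade-unique a p m m′ e e′ with toℕ-injective (trans (sym e) e′)
  ... | refl = cong (λ e″ → m , a , p , e″) (≡-irrelevant e e′)

  grade∘forget : ∀ b → grade (forget b) ≡ b
  grade∘forget (m , a , p , e) = grade-unique a p _ m _ e

injective⇒≤-card : {X : Set} {k n : ℕ} → isFinOfCard n X → (f : Fin k → X) → Injective _≡_ _≡_ f → k ≤ n
injective⇒≤-card fin f f-inj =
  fin _ ≤-irrelevant (λ e → injective⇒≤ {f = _≃_.to e ∘ f} (f-inj ∘ _≃_.injective e))

module _ (G : Graph) where

  sourceAt : {x y : N G} (w : W G x y) → Fin (length G w) → N G
  sourceAt {x} (e ⊙ w) Fin.zero = x
  sourceAt (e ⊙ w) (Fin.suc i) = sourceAt w i

  sourceAt-∈ : {x y : N G} (w : W G x y) (i : Fin (length G w)) → _∈_ G (sourceAt w i) w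
  sourceAt-∈ (e ⊙ w) Fin.zero = inj₁ refl
  sourceAt-∈ (e ⊙ w) (Fin.suc i) = inj₂ (sourceAt-∈ w i)

  index : {u x y : N G} (w : W G x y) → _∈_ G u w → Fin (length G w)
  index (e ⊙ w) (inj₁ _) = Fin.zero
  index (e ⊙ w) (inj₂ u∈w) = Fin.suc (index w u∈w)

  index-sourceAt-∈ : {x y : N G} (w : W G x y) (i : Fin (length G w)) → index w (sourceAt-∈ w i) ≡ i
  index-sourceAt-∈ (e ⊙ w) Fin.zero = refl
  index-sourceAt-∈ (e ⊙ w) (Fin.suc i) = cong Fin.suc (index-sourceAt-∈ w i)

  index-subst : {u v x y : N G} (w : W G x y) (u≡v : u ≡ v) (u∈w : _∈_ G u w) →
    index w (subst (λ t → _∈_ G t w) u≡v u∈w) ≡ index w u∈w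
  index-subst w refl u∈w = refl

  -- In a quasi-simple walk the membership proof of a node is unique, so it determines its position.
  sourceAt-injective : {x y : N G} (w : W G x y) → isQuasi G w → Injective _≡_ _≡_ (sourceAt w)
  sourceAt-injective w quasi {i} {j} same = begin
    i                                                         ≡⟨ sym (index-sourceAt-∈ w i) ⟩
    index w (sourceAt-∈ w i)                                  ≡⟨ sym (index-subst w same (sourceAt-∈ w i)) ⟩
    index w (subst (λ t → _∈_ G t w) same (sourceAt-∈ w i))   ≡⟨ cong (index w) (quasi (sourceAt w j) _ (sourceAt-∈ w j)) ⟩
    index w (sourceAt-∈ w j)                                  ≡⟨ index-sourceAt-∈ w j ⟩
    j                                                         ∎
    where open ≡-Reasoning

  quasi-length≤ : {n : ℕ} → isFinOfCard n (N G) → {x y : N G} (w : W G x y) → isQuasi G w → length G w ≤ n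
  quasi-length≤ fin w quasi = injective⇒≤-card fin (sourceAt w) (sourceAt-injective w quasi)

lemma4p22 : (G : Graph) (n : ℕ) → isFinOfCard n (N G) → (x y : N G) →
    Σ (W G x y) (isQuasi G) ≃ Σ ⟦ suc n ⟧ (λ m → qswalk G (toℕ m) x y)
lemma4p22 G n fin x y = Σ≃Σ-graded (isQuasi G) (length G) n (quasi-length≤ G fin)
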